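{- For any weak composition $\alpha=(\alpha_1,\ldots,\alpha_n)\in\mathbb{Z}_{\ge0}^n$ with skyline diagram $D(\alpha)$, \begin{align*} r_1(D(\alpha))+r_2(D(\alpha))+r_3(D(\alpha))=&\sum_{(i_1,i_2)\in\mathrm{inv}_1(\alpha)}(\alpha_{i_2}-\alpha_{i_1})+\sum_{(i_1,i_2,i_3)\in\mathrm{inv}_2(\alpha)}(\alpha_{i_2}-\alpha_{i_3})(\alpha_{i_3}-\alpha_{i_1})\\ &+\sum_{(i_1,i_2,i_3,i_4)\in\mathrm{inv}_3(\alpha)}(\alpha_{i_2}-\alpha_{i_1})(\alpha_{i_4}-\alpha_{i_3}), \end{align*} where $\mathrm{inv}_1(\alpha)=\{(i_1,i_2): i_1<i_2,\ \alpha_{i_1}<\alpha_{i_2}\}$, $\mathrm{inv}_2(\alpha)=\{(i_1,i_2,i_3): i_1<i_2<i_3,\ \alpha_{i_1}<\alpha_{i_3}<\alpha_{i_2}\}$, $\mathrm{inv}_3(\alpha)=\{(i_1,i_2,i_3,i_4): i_1<i_2<i_3<i_4,\ \alpha_{i_1}<\alpha_{i_2},\ \alpha_{i_3}<\alpha_{i_4}\}$.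
   Context: The skyline diagram $D(\alpha)$ is the set of boxes $\{(i,j):1\le j\le\alpha_i\}$, where $(i,j)$ is the box in row $i$ (rows numbered top to bottom) and column $j$. For a diagram $D$ (a finite set of boxes): $r_1(D)$ is the number of pairs of boxes $\{(i_1,j),(i_2,j)\}$ with $i_1<i_2$, $(i_1,j)\notin D$, $(i_2,j)\in D$; $r_2(D)$ is the number of 6-box sets $\{i_1,i_2,i_3\}\times\{j_1,j_2\}$ with $i_1<i_2<i_3$, $j_1<j_2$ such that either exactly $(i_2,j_1),(i_2,j_2),(i_3,j_1)$ among them lie in $D$, or exactly $(i_2,j_1),(i_2,j_2),(i_3,j_2)$ among them lie in $D$; $r_3(D)$ is the number of 4-box sets $\{(i_1,a),(i_2,a),(i_3,b),(i_4,b)\}$ with $i_1<i_2<i_3<i_4$ (with $a<b$, $a>b$ or $a=b$) such that $(i_1,a),(i_3,b)\notin D$ and $(i_2,a),(i_4,b)\in D$. Rows range over $[n]$ and columns over positive integers. -}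

module Defs where

open import Data.Nat using (ℕ; zero; suc; _+_; _*_; _∸_; _≤_; _<ᵇ_; _≤ᵇ_)
open import Data.Bool using (Bool; true; false; _∧_; not; if_then_else_)
open import Data.Fin using (Fin; toℕ)
open import Data.List using (List; map; upTo; allFin)
open import Data.Nat.ListAction using (sum)

-- A diagram with rows in [n]: a decidable set of boxes (i , j),
-- i a row (Fin n, top to bottom), j a column (positive integer).
Diagram : ℕ → Set
Diagram n = Fin n → ℕ → Bool

skyline : {n : ℕ} → (Fin n → ℕ) → Diagram n
skyline α i j = (1 ≤ᵇ j) ∧ (j ≤ᵇ α i)

Σ∈ : {A : Set} → List A → (A → ℕ) → ℕ
Σ∈ xs f = sum (map f xs)

⟦_⟧ : Bool → ℕ
⟦ b ⟧ = if b then 1 else 0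

rows : (n : ℕ) → List (Fin n)
rows n = allFin n

cols : ℕ → List ℕ
cols B = map suc (upTo B)

_<F_ : {n : ℕ} → Fin n → Fin n → Bool
i <F j = toℕ i <ᵇ toℕ j

-- r₁(D), for D with all boxes in columns 1..B
r₁ : {n : ℕ} → Diagram n → ℕ → ℕ
r₁ {n} D B =
  Σ∈ (rows n) λ i₁ → Σ∈ (rows n) λ i₂ → Σ∈ (cols B) λ j →
    ⟦ (i₁ <F i₂) ∧ not (D i₁ j) ∧ D i₂ j ⟧

-- r₂(D): the two alternatives are mutually exclusive (they differ at (i₃,j₁)),
-- so the count of 6-box sets is the sum of the two indicator counts.
r₂ : {n : ℕ} → Diagram n → ℕ → ℕ
r₂ {n} D B =
  Σ∈ (rows n) λ i₁ → Σ∈ (rows n) λ i₂ → Σ∈ (rows n) λ i₃ →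
  Σ∈ (cols B) λ j₁ → Σ∈ (cols B) λ j₂ →
    ⟦ (i₁ <F i₂) ∧ (i₂ <F i₃) ∧ (j₁ <ᵇ j₂) ∧
      not (D i₁ j₁) ∧ not (D i₁ j₂) ∧ D i₂ j₁ ∧ D i₂ j₂ ∧
      ((D i₃ j₁ ∧ not (D i₃ j₂)) ∨' (not (D i₃ j₁) ∧ D i₃ j₂)) ⟧
  where open import Data.Bool using () renaming (_∨_ to _∨'_)

r₃ : {n : ℕ} → Diagram n → ℕ → ℕ
r₃ {n} D B =
  Σ∈ (rows n) λ i₁ → Σ∈ (rows n) λ i₂ → Σ∈ (rows n) λ i₃ → Σ∈ (rows n) λ i₄ →
  Σ∈ (cols B) λ a → Σ∈ (cols B) λ b →
    ⟦ (i₁ <F i₂) ∧ (i₂ <F i₃) ∧ (i₃ <F i₄) ∧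
      not (D i₁ a) ∧ D i₂ a ∧ not (D i₃ b) ∧ D i₄ b ⟧

-- right-hand side: sums over inv₁, inv₂, inv₃ (all differences are positive there)
invSum₁ : {n : ℕ} → (Fin n → ℕ) → ℕ
invSum₁ {n} α =
  Σ∈ (rows n) λ i₁ → Σ∈ (rows n) λ i₂ →
    ⟦ (i₁ <F i₂) ∧ (α i₁ <ᵇ α i₂) ⟧ * (α i₂ ∸ α i₁)

invSum₂ : {n : ℕ} → (Fin n → ℕ) → ℕ
invSum₂ {n} α =
  Σ∈ (rows n) λ i₁ → Σ∈ (rows n) λ i₂ → Σ∈ (rows n) λ i₃ →
    ⟦ (i₁ <F i₂) ∧ (i₂ <F i₃) ∧ (α i₁ <ᵇ α i₃) ∧ (α i₃ <ᵇ α i₂) ⟧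
      * ((α i₂ ∸ α i₃) * (α i₃ ∸ α i₁))

invSum₃ : {n : ℕ} → (Fin n → ℕ) → ℕ
invSum₃ {n} α =
  Σ∈ (rows n) λ i₁ → Σ∈ (rows n) λ i₂ → Σ∈ (rows n) λ i₃ → Σ∈ (rows n) λ i₄ →
    ⟦ (i₁ <F i₂) ∧ (i₂ <F i₃) ∧ (i₃ <F i₄) ∧ (α i₁ <ᵇ α i₂) ∧ (α i₃ <ᵇ α i₄) ⟧
      * ((α i₂ ∸ α i₁) * (α i₄ ∸ α i₃))

-- Each of r₁, r₂, r₃ is a sum over row tuples of a sum over columns, and for fixed rows
-- the column sum is a product of interval lengths. Shifting columns by one, box (i , k + 1)
-- lies in D(α) iff k < α i, so "absent in row i, present in row i′" means k ∈ [α i , α i′⟩,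
-- which has α i′ ∸ α i elements. In r₃ the two columns are independent; in r₂ the columns
-- k₁ < k₂ must straddle α i₃ (k₁ < α i₃ ≤ k₂), which splits [α i₁ , α i₂⟩ into
-- [α i₁ , α i₃⟩ × [α i₃ , α i₂⟩. A product of such lengths vanishes unless the inequalities
-- defining inv₁, inv₂, inv₃ hold.
module Submission where

open import Defs
open import Algebra.Properties.CommutativeSemigroup using (interchange)
open import Data.Bool using (Bool; true; false; not; _∧_; _∨_)
open import Data.Bool.Properties using (∧-assoc)
open import Data.Fin using (Fin)
open import Data.List using (List; []; _∷_; [_]; _∷ʳ_; _++_; map; upTo)
open import Data.List.Properties using (map-cong; map-∘; map-++; upTo-∷ʳ)
open import Data.Nat using (ℕ; zero; suc; _+_; _*_; _∸_; _⊓_; _≤_; _<_; _≮_; _<ᵇ_; _≤ᵇ_)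
open import Data.Nat.ListAction using (sum)
open import Data.Nat.ListAction.Properties using (sum-++)
open import Data.Nat.Properties
  using ( +-identityʳ; +-comm; *-comm; *-distribˡ-+; *-distribʳ-+; *-zeroʳ
        ; ≤-trans; <⇒≤; <-trans; <-≤-trans; ≮⇒≥; m≤n⇒m≤1+n
        ; m⊓n≤m; m≤n⇒m⊓n≡m; m≥n⇒m⊓n≡n; m≤n⇒m∸n≡0; 0∸n≡0; +-∸-assoc
        ; <ᵇ-reflects-<; *-commutativeSemigroup)
open import Data.Product using (_×_; _,_)
open import Data.Sum using (_⊎_; inj₁; inj₂)
open import Function using (_∘_)
open import Relation.Nullary using (contradiction)
open import Relation.Nullary.Reflects using (Reflects; ofʸ; ofⁿ; ¬-reflects; _×-reflects_; _⊎-reflects_)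
open import Relation.Binary.PropositionalEquality
  using (_≡_; refl; sym; trans; cong; cong₂; module ≡-Reasoning)
open ≡-Reasoning

private
  variable
    A C : Set

Σ∈-cong : (xs : List A) {f g : A → ℕ} → (∀ x → f x ≡ g x) → Σ∈ xs f ≡ Σ∈ xs g
Σ∈-cong xs f≗g = cong sum (map-cong f≗g xs)

Σ∈-cong² : (xs : List A) (ys : List C) {f g : A → C → ℕ} → (∀ x y → f x y ≡ g x y) →
  Σ∈ xs (λ x → Σ∈ ys (f x)) ≡ Σ∈ xs (λ x → Σ∈ ys (g x))
Σ∈-cong² xs ys f≗g = Σ∈-cong xs λ x → Σ∈-cong ys (f≗g x)

Σ∈-zero : (xs : List A) → Σ∈ xs (λ _ → 0) ≡ 0
Σ∈-zero []       = refl
Σ∈-zero (_ ∷ xs) = Σ∈-zero xs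

Σ∈-map : (g : A → C) (xs : List A) (f : C → ℕ) → Σ∈ (map g xs) f ≡ Σ∈ xs (f ∘ g)
Σ∈-map g xs f = cong sum (sym (map-∘ xs))

*-distribˡ-Σ∈ : (c : ℕ) (xs : List A) (f : A → ℕ) → c * Σ∈ xs f ≡ Σ∈ xs (λ x → c * f x)
*-distribˡ-Σ∈ c []       f = *-zeroʳ c
*-distribˡ-Σ∈ c (x ∷ xs) f = trans (*-distribˡ-+ c (f x) _) (cong (c * f x +_) (*-distribˡ-Σ∈ c xs f))

*-distribʳ-Σ∈ : (c : ℕ) (xs : List A) (f : A → ℕ) → Σ∈ xs f * c ≡ Σ∈ xs (λ x → f x * c)
*-distribʳ-Σ∈ c []       f = refl
*-distribʳ-Σ∈ c (x ∷ xs) f = trans (*-distribʳ-+ c (f x) _) (cong (f x * c +_) (*-distribʳ-Σ∈ c xs f))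

Σ∈-*-Σ∈ : (xs : List A) (ys : List C) (f : A → ℕ) (g : C → ℕ) →
  Σ∈ xs (λ x → Σ∈ ys (λ y → f x * g y)) ≡ Σ∈ xs f * Σ∈ ys g
Σ∈-*-Σ∈ xs ys f g = begin
  Σ∈ xs (λ x → Σ∈ ys (λ y → f x * g y)) ≡⟨ Σ∈-cong xs (λ x → *-distribˡ-Σ∈ (f x) ys g) ⟨
  Σ∈ xs (λ x → f x * Σ∈ ys g)           ≡⟨ *-distribʳ-Σ∈ (Σ∈ ys g) xs f ⟨
  Σ∈ xs f * Σ∈ ys g                     ∎

Σ∈-upTo-suc : (B : ℕ) (f : ℕ → ℕ) → Σ∈ (upTo (suc B)) f ≡ Σ∈ (upTo B) f + f B
Σ∈-upTo-suc B f = begin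
  sum (map f (upTo (suc B)))      ≡⟨ cong (sum ∘ map f) (upTo-∷ʳ B) ⟨
  sum (map f (upTo B ∷ʳ B))       ≡⟨ cong sum (map-++ f (upTo B) [ B ]) ⟩
  sum (map f (upTo B) ++ [ f B ]) ≡⟨ sum-++ (map f (upTo B)) [ f B ] ⟩
  Σ∈ (upTo B) f + (f B + 0)       ≡⟨ cong (Σ∈ (upTo B) f +_) (+-identityʳ (f B)) ⟩
  Σ∈ (upTo B) f + f B             ∎

⟦∧⟧ : (p q : Bool) → ⟦ p ∧ q ⟧ ≡ ⟦ p ⟧ * ⟦ q ⟧
⟦∧⟧ true  q = sym (+-identityʳ ⟦ q ⟧)
⟦∧⟧ false q = refl

∸≡⟦<ᵇ⟧*∸ : (a b : ℕ) → b ∸ a ≡ ⟦ a <ᵇ b ⟧ * (b ∸ a)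
∸≡⟦<ᵇ⟧*∸ a b with a <ᵇ b | <ᵇ-reflects-< a b
... | true  | ofʸ _   = sym (+-identityʳ (b ∸ a))
... | false | ofⁿ a≮b = m≤n⇒m∸n≡0 (≮⇒≥ a≮b)

∸*∸≡⟦<ᵇ∧<ᵇ⟧*∸*∸ : (a b c d : ℕ) →
  (b ∸ a) * (d ∸ c) ≡ ⟦ (a <ᵇ b) ∧ (c <ᵇ d) ⟧ * ((b ∸ a) * (d ∸ c))
∸*∸≡⟦<ᵇ∧<ᵇ⟧*∸*∸ a b c d = begin
  (b ∸ a) * (d ∸ c)
    ≡⟨ cong₂ _*_ (∸≡⟦<ᵇ⟧*∸ a b) (∸≡⟦<ᵇ⟧*∸ c d) ⟩
  (⟦ p ⟧ * (b ∸ a)) * (⟦ q ⟧ * (d ∸ c))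
    ≡⟨ interchange *-commutativeSemigroup ⟦ p ⟧ (b ∸ a) ⟦ q ⟧ (d ∸ c) ⟩
  (⟦ p ⟧ * ⟦ q ⟧) * ((b ∸ a) * (d ∸ c))
    ≡⟨ cong (_* ((b ∸ a) * (d ∸ c))) (⟦∧⟧ p q) ⟨
  ⟦ p ∧ q ⟧ * ((b ∸ a) * (d ∸ c))
    ∎
  where
  p = a <ᵇ b
  q = c <ᵇ d

_∈[_,_⟩ : ℕ → ℕ → ℕ → Bool
k ∈[ a , b ⟩ = not (k <ᵇ a) ∧ (k <ᵇ b)

⊓∸-suc : (a b B : ℕ) → B ⊓ b ∸ a + ⟦ not (B <ᵇ a) ∧ (B <ᵇ b) ⟧ ≡ suc B ⊓ b ∸ a
⊓∸-suc a b B with B <ᵇ a | <ᵇ-reflects-< B a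
... | true  | ofʸ B<a = begin
  B ⊓ b ∸ a + 0  ≡⟨ +-identityʳ _ ⟩
  B ⊓ b ∸ a      ≡⟨ m≤n⇒m∸n≡0 (≤-trans (m⊓n≤m B b) (<⇒≤ B<a)) ⟩
  0              ≡⟨ m≤n⇒m∸n≡0 (≤-trans (m⊓n≤m (suc B) b) B<a) ⟨
  suc B ⊓ b ∸ a  ∎
... | false | ofⁿ B≮a with B <ᵇ b | <ᵇ-reflects-< B b
...   | true  | ofʸ B<b
  rewrite m≤n⇒m⊓n≡m (<⇒≤ B<b) | m≤n⇒m⊓n≡m B<b = trans (+-comm (B ∸ a) 1) (sym (+-∸-assoc 1 (≮⇒≥ B≮a)))
...   | false | ofⁿ B≮b
  rewrite m≥n⇒m⊓n≡n (≮⇒≥ B≮b) | m≥n⇒m⊓n≡n (m≤n⇒m≤1+n (≮⇒≥ B≮b)) = +-identityʳ (b ∸ a)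

count-∈[,⟩-⊓ : (a b B : ℕ) → Σ∈ (upTo B) (λ k → ⟦ k ∈[ a , b ⟩ ⟧) ≡ B ⊓ b ∸ a
count-∈[,⟩-⊓ a b zero    = sym (0∸n≡0 a)
count-∈[,⟩-⊓ a b (suc B) = begin
  Σ∈ (upTo (suc B)) f        ≡⟨ Σ∈-upTo-suc B f ⟩
  Σ∈ (upTo B) f + f B        ≡⟨ cong (_+ f B) (count-∈[,⟩-⊓ a b B) ⟩
  B ⊓ b ∸ a + f B            ≡⟨ ⊓∸-suc a b B ⟩
  suc B ⊓ b ∸ a              ∎
  where
  f : ℕ → ℕ
  f k = ⟦ k ∈[ a , b ⟩ ⟧

count-∈[,⟩ : (a b : ℕ) {B : ℕ} → b ≤ B → Σ∈ (upTo B) (λ k → ⟦ k ∈[ a , b ⟩ ⟧) ≡ b ∸ a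
count-∈[,⟩ a b {B} b≤B = trans (count-∈[,⟩-⊓ a b B) (cong (_∸ a) (m≥n⇒m⊓n≡n b≤B))

count-∈[,⟩² : (a b c d : ℕ) {B : ℕ} → b ≤ B → d ≤ B →
  Σ∈ (upTo B) (λ k → Σ∈ (upTo B) (λ l → ⟦ k ∈[ a , b ⟩ ∧ l ∈[ c , d ⟩ ⟧)) ≡ (b ∸ a) * (d ∸ c)
count-∈[,⟩² a b c d {B} b≤B d≤B = begin
  Σ∈ (upTo B) (λ k → Σ∈ (upTo B) (λ l → ⟦ k ∈[ a , b ⟩ ∧ l ∈[ c , d ⟩ ⟧))
    ≡⟨ Σ∈-cong² (upTo B) (upTo B) (λ k l → ⟦∧⟧ (k ∈[ a , b ⟩) (l ∈[ c , d ⟩)) ⟩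
  Σ∈ (upTo B) (λ k → Σ∈ (upTo B) (λ l → ⟦ k ∈[ a , b ⟩ ⟧ * ⟦ l ∈[ c , d ⟩ ⟧))
    ≡⟨ Σ∈-*-Σ∈ (upTo B) (upTo B) _ _ ⟩
  Σ∈ (upTo B) (λ k → ⟦ k ∈[ a , b ⟩ ⟧) * Σ∈ (upTo B) (λ l → ⟦ l ∈[ c , d ⟩ ⟧)
    ≡⟨ cong₂ _*_ (count-∈[,⟩ a b b≤B) (count-∈[,⟩ c d d≤B) ⟩
  (b ∸ a) * (d ∸ c) ∎

reflects-≡ : {P Q : Set} {p q : Bool} → Reflects P p → Reflects Q q → (P → Q) → (Q → P) → p ≡ q
reflects-≡ (ofʸ _)  (ofʸ _)  _   _   = refl
reflects-≡ (ofʸ P)  (ofⁿ ¬Q) P→Q _   = contradiction (P→Q P) ¬Q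
reflects-≡ (ofⁿ ¬P) (ofʸ Q)  _   Q→P = contradiction (Q→P Q) ¬P
reflects-≡ (ofⁿ _)  (ofⁿ _)  _   _   = refl

exactly-one-below≡∈[,⟩ : (x y z k₁ k₂ : ℕ) →
  (k₁ <ᵇ k₂) ∧ not (k₁ <ᵇ x) ∧ not (k₂ <ᵇ x) ∧ (k₁ <ᵇ y) ∧ (k₂ <ᵇ y) ∧
    (((k₁ <ᵇ z) ∧ not (k₂ <ᵇ z)) ∨ (not (k₁ <ᵇ z) ∧ (k₂ <ᵇ z)))
  ≡ k₁ ∈[ x , z ⟩ ∧ k₂ ∈[ z , y ⟩
exactly-one-below≡∈[,⟩ x y z k₁ k₂ =
  reflects-≡
    (r k₁ k₂ ×-reflects ¬r k₁ x ×-reflects ¬r k₂ x ×-reflects r k₁ y ×-reflects r k₂ y ×-reflects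
      ((r k₁ z ×-reflects ¬r k₂ z) ⊎-reflects (¬r k₁ z ×-reflects r k₂ z)))
    ((¬r k₁ x ×-reflects r k₁ z) ×-reflects (¬r k₂ z ×-reflects r k₂ y))
    sound complete
  where
  r : (m n : ℕ) → Reflects (m < n) (m <ᵇ n)
  r = <ᵇ-reflects-<
  ¬r : (m n : ℕ) → Reflects (m ≮ n) (not (m <ᵇ n))
  ¬r m n = ¬-reflects (r m n)

  sound : k₁ < k₂ × k₁ ≮ x × k₂ ≮ x × k₁ < y × k₂ < y × ((k₁ < z × k₂ ≮ z) ⊎ (k₁ ≮ z × k₂ < z)) →
          (k₁ ≮ x × k₁ < z) × (k₂ ≮ z × k₂ < y)
  sound (_     , k₁≮x , _ , _ , k₂<y , inj₁ (k₁<z , k₂≮z)) = (k₁≮x , k₁<z) , (k₂≮z , k₂<y)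
  sound (k₁<k₂ , _    , _ , _ , _    , inj₂ (k₁≮z , k₂<z)) = contradiction (<-trans k₁<k₂ k₂<z) k₁≮z

  complete : (k₁ ≮ x × k₁ < z) × (k₂ ≮ z × k₂ < y) →
             k₁ < k₂ × k₁ ≮ x × k₂ ≮ x × k₁ < y × k₂ < y × ((k₁ < z × k₂ ≮ z) ⊎ (k₁ ≮ z × k₂ < z))
  complete ((k₁≮x , k₁<z) , (k₂≮z , k₂<y)) =
    k₁<k₂ , k₁≮x , (λ k₂<x → k₁≮x (<-trans k₁<k₂ k₂<x)) , <-trans k₁<k₂ k₂<y , k₂<y , inj₁ (k₁<z , k₂≮z)
    where
    k₁<k₂ : k₁ < k₂
    k₁<k₂ = <-≤-trans k₁<z (≮⇒≥ k₂≮z)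

skylineRow : ℕ → ℕ → Bool
skylineRow x j = (1 ≤ᵇ j) ∧ (j ≤ᵇ x)

-- Definitionally skylineRow x (suc k) = k <ᵇ x, so shifting columns to 0 , … , B - 1
-- turns every skyline condition into a comparison with k.
Σ∈-cols : (B : ℕ) (f : ℕ → ℕ) → Σ∈ (cols B) f ≡ Σ∈ (upTo B) (f ∘ suc)
Σ∈-cols B = Σ∈-map suc (upTo B)

Σ∈-cols² : (B : ℕ) (f : ℕ → ℕ → ℕ) →
  Σ∈ (cols B) (λ j₁ → Σ∈ (cols B) (f j₁)) ≡ Σ∈ (upTo B) (λ k₁ → Σ∈ (upTo B) (f (suc k₁) ∘ suc))
Σ∈-cols² B f = trans (Σ∈-cols B _) (Σ∈-cong (upTo B) λ k₁ → Σ∈-cols B (f (suc k₁)))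

Σ∈-guard : (g : Bool) (xs : List A) {p : A → Bool} {s : Bool} {w : ℕ} →
  Σ∈ xs (λ x → ⟦ p x ⟧) ≡ ⟦ s ⟧ * w → Σ∈ xs (λ x → ⟦ g ∧ p x ⟧) ≡ ⟦ g ∧ s ⟧ * w
Σ∈-guard true  xs eq = eq
Σ∈-guard false xs _  = Σ∈-zero xs

Σ∈-guard² : (g : Bool) (xs : List A) (ys : List C) {p : A → C → Bool} {s : Bool} {w : ℕ} →
  Σ∈ xs (λ x → Σ∈ ys (λ y → ⟦ p x y ⟧)) ≡ ⟦ s ⟧ * w →
  Σ∈ xs (λ x → Σ∈ ys (λ y → ⟦ g ∧ p x y ⟧)) ≡ ⟦ g ∧ s ⟧ * w
Σ∈-guard² true  xs ys eq = eq
Σ∈-guard² false xs ys _  = trans (Σ∈-cong xs λ _ → Σ∈-zero ys) (Σ∈-zero xs)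

r₁-column-count : (x y : ℕ) {B : ℕ} → y ≤ B →
  Σ∈ (cols B) (λ j → ⟦ not (skylineRow x j) ∧ skylineRow y j ⟧) ≡ ⟦ x <ᵇ y ⟧ * (y ∸ x)
r₁-column-count x y {B} y≤B = begin
  Σ∈ (cols B) (λ j → ⟦ not (skylineRow x j) ∧ skylineRow y j ⟧) ≡⟨ Σ∈-cols B _ ⟩
  Σ∈ (upTo B) (λ k → ⟦ k ∈[ x , y ⟩ ⟧)                        ≡⟨ count-∈[,⟩ x y y≤B ⟩
  y ∸ x                                                       ≡⟨ ∸≡⟦<ᵇ⟧*∸ x y ⟩
  ⟦ x <ᵇ y ⟧ * (y ∸ x)                                         ∎

r₂-column-count : (x y z : ℕ) {B : ℕ} → y ≤ B → z ≤ B →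
  Σ∈ (cols B) (λ j₁ → Σ∈ (cols B) λ j₂ →
    ⟦ (j₁ <ᵇ j₂) ∧ not (skylineRow x j₁) ∧ not (skylineRow x j₂) ∧
      skylineRow y j₁ ∧ skylineRow y j₂ ∧
      ((skylineRow z j₁ ∧ not (skylineRow z j₂)) ∨ (not (skylineRow z j₁) ∧ skylineRow z j₂)) ⟧)
  ≡ ⟦ (x <ᵇ z) ∧ (z <ᵇ y) ⟧ * ((y ∸ z) * (z ∸ x))
r₂-column-count x y z {B} y≤B z≤B = begin
  _ ≡⟨ Σ∈-cols² B _ ⟩
  _ ≡⟨ Σ∈-cong² (upTo B) (upTo B) (λ k₁ k₂ → cong ⟦_⟧ (exactly-one-below≡∈[,⟩ x y z k₁ k₂)) ⟩
  Σ∈ (upTo B) (λ k₁ → Σ∈ (upTo B) λ k₂ → ⟦ k₁ ∈[ x , z ⟩ ∧ k₂ ∈[ z , y ⟩ ⟧)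
    ≡⟨ count-∈[,⟩² x z z y z≤B y≤B ⟩
  (z ∸ x) * (y ∸ z)
    ≡⟨ ∸*∸≡⟦<ᵇ∧<ᵇ⟧*∸*∸ x z z y ⟩
  ⟦ (x <ᵇ z) ∧ (z <ᵇ y) ⟧ * ((z ∸ x) * (y ∸ z))
    ≡⟨ cong (⟦ (x <ᵇ z) ∧ (z <ᵇ y) ⟧ *_) (*-comm (z ∸ x) (y ∸ z)) ⟩
  ⟦ (x <ᵇ z) ∧ (z <ᵇ y) ⟧ * ((y ∸ z) * (z ∸ x))
    ∎

r₃-column-count : (x₁ x₂ x₃ x₄ : ℕ) {B : ℕ} → x₂ ≤ B → x₄ ≤ B →
  Σ∈ (cols B) (λ a → Σ∈ (cols B) λ b →
    ⟦ not (skylineRow x₁ a) ∧ skylineRow x₂ a ∧ not (skylineRow x₃ b) ∧ skylineRow x₄ b ⟧)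
  ≡ ⟦ (x₁ <ᵇ x₂) ∧ (x₃ <ᵇ x₄) ⟧ * ((x₂ ∸ x₁) * (x₄ ∸ x₃))
r₃-column-count x₁ x₂ x₃ x₄ {B} x₂≤B x₄≤B = begin
  _ ≡⟨ Σ∈-cols² B _ ⟩
  _ ≡⟨ Σ∈-cong² (upTo B) (upTo B) (λ k l → cong ⟦_⟧ (∧-assoc (not (k <ᵇ x₁)) (k <ᵇ x₂) _)) ⟨
  Σ∈ (upTo B) (λ k → Σ∈ (upTo B) λ l → ⟦ k ∈[ x₁ , x₂ ⟩ ∧ l ∈[ x₃ , x₄ ⟩ ⟧)
    ≡⟨ count-∈[,⟩² x₁ x₂ x₃ x₄ x₂≤B x₄≤B ⟩
  (x₂ ∸ x₁) * (x₄ ∸ x₃)                                 ≡⟨ ∸*∸≡⟦<ᵇ∧<ᵇ⟧*∸*∸ x₁ x₂ x₃ x₄ ⟩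
  ⟦ (x₁ <ᵇ x₂) ∧ (x₃ <ᵇ x₄) ⟧ * ((x₂ ∸ x₁) * (x₄ ∸ x₃))  ∎

module _ {n : ℕ} (α : Fin n → ℕ) {B : ℕ} (α≤B : (i : Fin n) → α i ≤ B) where

  r₁-skyline : r₁ (skyline α) B ≡ invSum₁ α
  r₁-skyline = Σ∈-cong (rows n) λ i₁ → Σ∈-cong (rows n) λ i₂ →
    Σ∈-guard (i₁ <F i₂) (cols B) (r₁-column-count (α i₁) (α i₂) (α≤B i₂))

  r₂-skyline : r₂ (skyline α) B ≡ invSum₂ α
  r₂-skyline = Σ∈-cong (rows n) λ i₁ → Σ∈-cong (rows n) λ i₂ → Σ∈-cong (rows n) λ i₃ →
    Σ∈-guard² (i₁ <F i₂) (cols B) (cols B) (Σ∈-guard² (i₂ <F i₃) (cols B) (cols B)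
      (r₂-column-count (α i₁) (α i₂) (α i₃) (α≤B i₂) (α≤B i₃)))

  r₃-skyline : r₃ (skyline α) B ≡ invSum₃ α
  r₃-skyline = Σ∈-cong (rows n) λ i₁ → Σ∈-cong (rows n) λ i₂ → Σ∈-cong (rows n) λ i₃ →
    Σ∈-cong (rows n) λ i₄ →
    Σ∈-guard² (i₁ <F i₂) (cols B) (cols B) (Σ∈-guard² (i₂ <F i₃) (cols B) (cols B)
      (Σ∈-guard² (i₃ <F i₄) (cols B) (cols B)
        (r₃-column-count (α i₁) (α i₂) (α i₃) (α i₄) (α≤B i₂) (α≤B i₄))))

theorem4p2 : (n : ℕ) (α : Fin n → ℕ) (B : ℕ) → ((i : Fin n) → α i ≤ B) →
    r₁ (skyline α) B + r₂ (skyline α) B + r₃ (skyline α) B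
      ≡ invSum₁ α + invSum₂ α + invSum₃ α
theorem4p2 n α B α≤B = cong₂ _+_ (cong₂ _+_ (r₁-skyline α α≤B) (r₂-skyline α α≤B)) (r₃-skyline α α≤B)
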